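{- Let $n\geq 3$ and let $D_n=\langle a,b\mid a^n=b^2=(ab)^2=e\rangle$ be the dihedral group of order $2n$. Then $OD(D_n)$ is the star graph $S_{2n}$ if and only if $n$ is prime.
   Context: For a finite group $G$, the order divisor graph $OD(G)$ is the simple undirected graph with vertex set $G$ in which two distinct vertices $a,b$ are adjacent if and only if $o(a)\neq o(b)$ and either $o(a)\mid o(b)$ or $o(b)\mid o(a)$. $S_m$ denotes the star graph on $m$ vertices: a tree with one vertex of degree $m-1$ and all other vertices of degree $1$. -}

module Defs where

open import Data.Nat using (ℕ; zero; suc; _+_; _∸_; _≤_; _<_; NonZero)
open import Data.Nat.DivMod using (_mod_)
open import Data.Nat.Divisibility using (_∣_)
open import Data.Fin using (Fin; toℕ)
open import Data.Bool using (Bool; true; false)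
open import Data.Product using (_×_; _,_; ∃)
open import Data.Sum using (_⊎_)
open import Relation.Binary.PropositionalEquality using (_≡_; _≢_)

-- Concrete model of the dihedral group D_n = ⟨a,b | a^n = b^2 = (ab)^2 = e⟩ of order 2n:
-- (false , i) represents a^i, (true , i) represents a^i b  (0 ≤ i < n).
Dih : ℕ → Set
Dih n = Bool × Fin n

module _ {n : ℕ} .{{_ : NonZero n}} where

  e : Dih n
  e = false , (0 mod n)

  -- multiplication, using b a^j = a^{-j} b:
  --   a^i · a^j = a^{i+j},  a^i · a^j b = a^{i+j} b,
  --   a^i b · a^j = a^{i-j} b,  a^i b · a^j b = a^{i-j}
  _·_ : Dih n → Dih n → Dih n
  (false , i) · (false , j) = false , ((toℕ i + toℕ j) mod n)
  (false , i) · (true  , j) = true  , ((toℕ i + toℕ j) mod n)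
  (true  , i) · (false , j) = true  , ((toℕ i + (n ∸ toℕ j)) mod n)
  (true  , i) · (true  , j) = false , ((toℕ i + (n ∸ toℕ j)) mod n)

  pow : Dih n → ℕ → Dih n
  pow x zero    = e
  pow x (suc k) = x · pow x k

  IsOrder : Dih n → ℕ → Set
  IsOrder x k = (1 ≤ k) × (pow x k ≡ e) × (∀ j → 1 ≤ j → j < k → pow x j ≢ e)

  ODAdj : Dih n → Dih n → Set
  ODAdj x y = (x ≢ y) × ∃ λ k → ∃ λ l →
    IsOrder x k × IsOrder y l × (k ≢ l) × ((k ∣ l) ⊎ (l ∣ k))

StarAdj : {m : ℕ} → Fin m → Fin m → Set
StarAdj i j = (i ≢ j) × ((toℕ i ≡ 0) ⊎ (toℕ j ≡ 0))

record GraphIso {A B : Set} (R : A → A → Set) (S : B → B → Set) : Set where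
  field
    to       : A → B
    from     : B → A
    from-to  : ∀ x → from (to x) ≡ x
    to-from  : ∀ y → to (from y) ≡ y
    adj-to   : ∀ x y → R x y → S (to x) (to y)
    adj-from : ∀ x y → S (to x) (to y) → R x y

-- For a prime n ≥ 3 every non-identity element of D_n has order 2 (a reflection) or
-- n (a nontrivial rotation), and 2 and n are incomparable under divisibility, so the
-- only edges of OD(D_n) are those at e: it is the star centred at e. Conversely a star
-- has no triangle, whereas for n = q d with 1 < d < n the identity, the rotation a^q
-- of order d and the rotation a of order n are pairwise adjacent.
module Submission where

open import Defs
open import Data.Nat using (ℕ; _≤_; _*_; NonZero)
open import Data.Nat.Primality using (Prime)
open import Data.Fin using (Fin)
open import Function.Bundles using (_⇔_)

open import Data.Bool as Bool using (Bool; true; false)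
open import Data.Empty using (⊥; ⊥-elim)
open import Data.Fin as Fin using (toℕ; fromℕ<)
open import Data.Fin.Patterns using (0F)
open import Data.Fin.Properties using (toℕ-injective; toℕ-fromℕ<; toℕ<n; 2↔Bool; *↔×)
open import Data.Nat using (zero; suc; _+_; _∸_; _<_; _%_; z≤n; s≤s; ≢-nonZero⁻¹; >-nonZero⁻¹; n>1⇒nonTrivial; nonTrivial⇒n>1)
open import Data.Nat.DivMod using (_mod_; %-distribˡ-+; m%n%n≡m%n; [m+n]%n≡m%n; m<n⇒m%n≡m; n%n≡0)
open import Data.Nat.Divisibility using (_∣_; divides; ∣-refl; ∣⇒≤; >⇒∤; 1∣_; m∣m*n; m%n≡0⇒n∣m; n∣m⇒m%n≡0)
open import Data.Nat.Primality using (Composite; composite; euclidsLemma; ¬composite⇒prime)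
open import Data.Nat.Properties
  using (<-cmp; <-trans; <⇒≤; <⇒≢; <⇒≱; *-comm; *-zeroʳ; *-identityˡ; *-monoˡ-<; m<m*n; m*n≢0; m*n≢0⇒m≢0; m+[n∸m]≡n)
open import Data.Product using (_×_; _,_; proj₁; proj₂)
open import Data.Product.Properties using (≡-dec)
open import Data.Product.Function.NonDependent.Propositional using (_×-↔_)
open import Data.Sum using (_⊎_; inj₁; inj₂; [_,_]′)
import Data.Sum as Sum
open import Function.Base using (_∘_; case_of_; it)
open import Function.Bundles using (_↔_; Inverse; Equivalence; mk⇔)
open import Function.Properties.Inverse using (↔-sym; ↔-trans; ↔-refl)
open import Relation.Binary.Definitions using (tri<; tri≈; tri>)
open import Relation.Binary.PropositionalEquality using (_≡_; _≢_; refl; sym; trans; cong; subst; module ≡-Reasoning)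
open import Relation.Nullary using (¬_; Dec; yes; no)

TriangleFree : {A : Set} → (A → A → Set) → Set
TriangleFree R = ∀ x y z → R x y → R y z → R x z → ⊥

IsStar : {A : Set} → (A → A → Set) → A → Set
IsStar R c = ∀ x y → R x y ⇔ (x ≢ y × (x ≡ c ⊎ y ≡ c))

module _ {m : ℕ} where

  StarAdj-triangleFree : TriangleFree (StarAdj {m})
  StarAdj-triangleFree u v w (u≢v , inj₁ u≡0) (v≢w , v≡0⊎w≡0) (u≢w , _) =
    [ (λ v≡0 → u≢v (toℕ-injective (trans u≡0 (sym v≡0))))
    , (λ w≡0 → u≢w (toℕ-injective (trans u≡0 (sym w≡0)))) ]′ v≡0⊎w≡0
  StarAdj-triangleFree u v w (u≢v , inj₂ v≡0) (v≢w , _) (u≢w , u≡0⊎w≡0) =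
    [ (λ u≡0 → u≢v (toℕ-injective (trans u≡0 (sym v≡0))))
    , (λ w≡0 → v≢w (toℕ-injective (trans v≡0 (sym w≡0)))) ]′ u≡0⊎w≡0

  IsStar⇒GraphIso : {A : Set} {R : A → A → Set} {c : A} (f : A ↔ Fin m) →
                    toℕ (Inverse.to f c) ≡ 0 → IsStar R c → GraphIso R (StarAdj {m})
  IsStar⇒GraphIso {R = R} {c} f f[c]≡0 star = record
    { to       = to
    ; from     = from
    ; from-to  = strictlyInverseʳ
    ; to-from  = strictlyInverseˡ
    ; adj-to   = λ x y r → let x≢y , centred = Equivalence.to (star x y) r in
                   (λ fx≡fy → x≢y (to-injective fx≡fy)) , Sum.map ≡c⇒toℕ≡0 ≡c⇒toℕ≡0 centred
    ; adj-from = λ x y (fx≢fy , centred) → Equivalence.from (star x y)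
                   ((λ x≡y → fx≢fy (cong to x≡y)) , Sum.map toℕ≡0⇒≡c toℕ≡0⇒≡c centred)
    }
    where
    open Inverse f
    to-injective : ∀ {x y} → to x ≡ to y → x ≡ y
    to-injective {x} {y} fx≡fy =
      trans (sym (strictlyInverseʳ x)) (trans (cong from fx≡fy) (strictlyInverseʳ y))
    ≡c⇒toℕ≡0 : ∀ {x} → x ≡ c → toℕ (to x) ≡ 0
    ≡c⇒toℕ≡0 refl = f[c]≡0
    toℕ≡0⇒≡c : ∀ {x} → toℕ (to x) ≡ 0 → x ≡ c
    toℕ≡0⇒≡c h = to-injective (toℕ-injective (trans h (sym f[c]≡0)))

triangleFree-pullback : {A B : Set} {R : A → A → Set} {S : B → B → Set} →
                        GraphIso R S → TriangleFree S → TriangleFree R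
triangleFree-pullback iso noTriangle x y z rxy ryz rxz =
  noTriangle (to x) (to y) (to z) (adj-to x y rxy) (adj-to y z ryz) (adj-to x z rxz)
  where open GraphIso iso

Dih↔Fin : {n : ℕ} → Dih n ↔ Fin (2 * n)
Dih↔Fin = ↔-trans (↔-sym 2↔Bool ×-↔ ↔-refl) (↔-sym *↔×)

module _ {n : ℕ} .{{_ : NonZero n}} where

  _≟_ : (x y : Dih n) → Dec (x ≡ y)
  _≟_ = ≡-dec Bool._≟_ Fin._≟_

  toℕ-mod : ∀ a → toℕ (a mod n) ≡ a % n
  toℕ-mod a = toℕ-fromℕ< _

  0%n≡0 : 0 % n ≡ 0
  0%n≡0 = m<n⇒m%n≡m (>-nonZero⁻¹ n)

  %-cong⇒mod-cong : ∀ a b → a % n ≡ b % n → a mod n ≡ b mod n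
  %-cong⇒mod-cong a b a≡b = toℕ-injective (trans (toℕ-mod a) (trans a≡b (sym (toℕ-mod b))))

  [m+n%d]%d≡[m+n]%d : ∀ a b → (a + b % n) % n ≡ (a + b) % n
  [m+n%d]%d≡[m+n]%d a b = begin
    (a + b % n) % n          ≡⟨ %-distribˡ-+ a (b % n) n ⟩
    (a % n + b % n % n) % n  ≡⟨ cong (λ r → (a % n + r) % n) (m%n%n≡m%n b n) ⟩
    (a % n + b % n) % n      ≡⟨ %-distribˡ-+ a b n ⟨
    (a + b) % n              ∎
    where open ≡-Reasoning

  pow-rotation : ∀ (i : Fin n) k → pow (false , i) k ≡ (false , (k * toℕ i) mod n)
  pow-rotation i zero    = refl
  pow-rotation i (suc k) = begin
    pow (false , i) (suc k)                  ≡⟨ cong ((false , i) ·_) (pow-rotation i k) ⟩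
    (false , (toℕ i + toℕ (kᵢ mod n)) mod n)  ≡⟨ cong (false ,_) (%-cong⇒mod-cong _ (toℕ i + kᵢ) reduce) ⟩
    (false , (suc k * toℕ i) mod n)          ∎
    where
    open ≡-Reasoning
    kᵢ : ℕ
    kᵢ = k * toℕ i
    reduce : (toℕ i + toℕ (kᵢ mod n)) % n ≡ (toℕ i + kᵢ) % n
    reduce = trans (cong (λ r → (toℕ i + r) % n) (toℕ-mod kᵢ)) ([m+n%d]%d≡[m+n]%d (toℕ i) kᵢ)

  pow-rotation≡e⇒∣ : ∀ (i : Fin n) k → pow (false , i) k ≡ e → n ∣ k * toℕ i
  pow-rotation≡e⇒∣ i k xᵏ≡e = m%n≡0⇒n∣m _ n (begin
    (k * toℕ i) % n           ≡⟨ toℕ-mod (k * toℕ i) ⟨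
    toℕ ((k * toℕ i) mod n)   ≡⟨ cong (toℕ ∘ proj₂) (trans (sym (pow-rotation i k)) xᵏ≡e) ⟩
    toℕ (0 mod n)             ≡⟨ toℕ-mod 0 ⟩
    0 % n                     ≡⟨ 0%n≡0 ⟩
    0                         ∎)
    where open ≡-Reasoning

  ∣⇒pow-rotation≡e : ∀ (i : Fin n) k → n ∣ k * toℕ i → pow (false , i) k ≡ e
  ∣⇒pow-rotation≡e i k n∣ki =
    trans (pow-rotation i k) (cong (false ,_) (%-cong⇒mod-cong (k * toℕ i) 0
      (trans (n∣m⇒m%n≡0 _ n n∣ki) (sym 0%n≡0))))

  IsOrder-unique : ∀ {x : Dih n} {k l} → IsOrder x k → IsOrder x l → k ≡ l
  IsOrder-unique {k = k} {l} (1≤k , xᵏ≡e , k-least) (1≤l , xˡ≡e , l-least) with <-cmp k l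
  ... | tri< k<l _ _ = ⊥-elim (l-least k 1≤k k<l xᵏ≡e)
  ... | tri≈ _ k≡l _ = k≡l
  ... | tri> _ _ l<k = ⊥-elim (k-least l 1≤l l<k xˡ≡e)

  ODAdj-of-orders : ∀ {x y : Dih n} {k l} → IsOrder x k → IsOrder y l →
                    k ≢ l → k ∣ l ⊎ l ∣ k → ODAdj x y
  ODAdj-of-orders {k = k} {l} ox oy k≢l k∣l⊎l∣k =
    (λ { refl → k≢l (IsOrder-unique ox oy) }) , k , l , ox , oy , k≢l , k∣l⊎l∣k

  ODAdj⇒orders : ∀ {x y : Dih n} {k l} → ODAdj x y → IsOrder x k → IsOrder y l →
                 k ≢ l × (k ∣ l ⊎ l ∣ k)
  ODAdj⇒orders (_ , k′ , l′ , ok′ , ol′ , k′≢l′ , k′∣l′⊎l′∣k′) ok ol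
    rewrite IsOrder-unique ok ok′ | IsOrder-unique ol ol′ = k′≢l′ , k′∣l′⊎l′∣k′

  ODAdj-sym : ∀ {x y : Dih n} → ODAdj x y → ODAdj y x
  ODAdj-sym (x≢y , k , l , ox , oy , k≢l , k∣l⊎l∣k) =
    (x≢y ∘ sym) , l , k , oy , ox , (k≢l ∘ sym) , Sum.swap k∣l⊎l∣k

  rotation-order : ∀ (i : Fin n) d → toℕ i * d ≡ n → IsOrder (false , i) d
  rotation-order i zero    i*0≡n = ⊥-elim (≢-nonZero⁻¹ n (trans (sym i*0≡n) (*-zeroʳ (toℕ i))))
  rotation-order i (suc d) i*d≡n =
    s≤s z≤n , ∣⇒pow-rotation≡e i (suc d) n∣d*i , minimal
    where
    n∣d*i : n ∣ suc d * toℕ i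
    n∣d*i = subst (n ∣_) (trans (sym i*d≡n) (*-comm (toℕ i) (suc d))) ∣-refl
    instance
      i≢0 : NonZero (toℕ i)
      i≢0 = m*n≢0⇒m≢0 (toℕ i) {{subst NonZero (sym i*d≡n) it}}
    minimal : ∀ j → 1 ≤ j → j < suc d → pow (false , i) j ≢ e
    minimal j@(suc _) _ j<d xʲ≡e = <⇒≱ j*i<n (∣⇒≤ {{m*n≢0 j (toℕ i)}} (pow-rotation≡e⇒∣ i j xʲ≡e))
      where
      j*i<n : j * toℕ i < n
      j*i<n = subst (j * toℕ i <_) (trans (*-comm (suc d) (toℕ i)) i*d≡n) (*-monoˡ-< (toℕ i) j<d)

module _ {m : ℕ} where

  private
    n : ℕ
    n = suc m

  e-order : IsOrder (e {n}) 1
  e-order = s≤s z≤n , ∣⇒pow-rotation≡e 0F 1 (divides 0 refl) , λ { _ (s≤s z≤n) (s≤s ()) }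

  reflection-order : ∀ (i : Fin n) → IsOrder (true , i) 2
  reflection-order i = s≤s z≤n , reflection² , λ
    { 1 _ _ r≡e → case cong proj₁ r≡e of λ () ; (suc (suc _)) _ (s≤s (s≤s ())) }
    where
    open ≡-Reasoning
    r·e≡r : (true , i) · e ≡ (true , i)
    r·e≡r = cong (true ,_) (toℕ-injective (begin
      toℕ ((toℕ i + n) mod n)  ≡⟨ toℕ-mod (toℕ i + n) ⟩
      (toℕ i + n) % n          ≡⟨ [m+n]%n≡m%n (toℕ i) n ⟩
      toℕ i % n                ≡⟨ m<n⇒m%n≡m (toℕ<n i) ⟩
      toℕ i                    ∎))
    r·r≡e : (true , i) · (true , i) ≡ e
    r·r≡e = cong (false ,_) (%-cong⇒mod-cong (toℕ i + (n ∸ toℕ i)) 0 (begin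
      (toℕ i + (n ∸ toℕ i)) % n  ≡⟨ cong (_% n) (m+[n∸m]≡n (<⇒≤ (toℕ<n i))) ⟩
      n % n                      ≡⟨ n%n≡0 n ⟩
      0                          ∎))
    reflection² : pow (true , i) 2 ≡ e
    reflection² = trans (cong ((true , i) ·_) r·e≡r) r·r≡e

  rotation-order-prime : Prime n → ∀ (i : Fin m) → IsOrder (false , Fin.suc i) n
  rotation-order-prime p i = s≤s z≤n , ∣⇒pow-rotation≡e _ n (m∣m*n (toℕ (Fin.suc i))) , minimal
    where
    minimal : ∀ j → 1 ≤ j → j < n → pow (false , Fin.suc i) j ≢ e
    minimal j@(suc _) _ j<n xʲ≡e with euclidsLemma j (toℕ (Fin.suc i)) p (pow-rotation≡e⇒∣ _ j xʲ≡e)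
    ... | inj₁ n∣j = >⇒∤ j<n n∣j
    ... | inj₂ n∣i = >⇒∤ (toℕ<n (Fin.suc i)) n∣i

  composite⇒¬triangleFree : Composite n → ¬ TriangleFree (ODAdj {n})
  composite⇒¬triangleFree (composite {d} d<n (divides q n≡q*d)) noTriangle =
    noTriangle e aᵠ a
      (ODAdj-of-orders e-order aᵠ-order (<⇒≢ 1<d) (inj₁ (1∣ d)))
      (ODAdj-of-orders aᵠ-order a-order (<⇒≢ d<n) (inj₁ (divides q n≡q*d)))
      (ODAdj-of-orders e-order a-order (<⇒≢ 1<n) (inj₁ (1∣ n)))
    where
    1<d : 1 < d
    1<d = nonTrivial⇒n>1 d
    1<n : 1 < n
    1<n = <-trans 1<d d<n
    q<n : q < n
    q<n = subst (q <_) (sym n≡q*d) (m<m*n q d {{m*n≢0⇒m≢0 q {{subst NonZero n≡q*d _}}}} 1<d)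
    a aᵠ : Dih n
    a  = false , fromℕ< 1<n
    aᵠ = false , fromℕ< q<n
    a-order : IsOrder a n
    a-order = rotation-order _ n (trans (cong (_* n) (toℕ-fromℕ< 1<n)) (*-identityˡ n))
    aᵠ-order : IsOrder aᵠ d
    aᵠ-order = rotation-order _ d (trans (cong (_* d) (toℕ-fromℕ< q<n)) (sym n≡q*d))

  triangleFree⇒prime : 2 ≤ n → TriangleFree (ODAdj {n}) → Prime n
  triangleFree⇒prime 2≤n noTriangle =
    ¬composite⇒prime {{n>1⇒nonTrivial 2≤n}} (λ c → composite⇒¬triangleFree c noTriangle)

  order-2-or-n : Prime n → ∀ {x : Dih n} → x ≢ e → IsOrder x 2 ⊎ IsOrder x n
  order-2-or-n p {false , 0F}        x≢e = ⊥-elim (x≢e refl)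
  order-2-or-n p {false , Fin.suc i} _   = inj₂ (rotation-order-prime p i)
  order-2-or-n p {true  , i}         _   = inj₁ (reflection-order i)

  prime⇒2∤n∧n∤2 : Prime n → 3 ≤ n → ¬ (2 ∣ n ⊎ n ∣ 2)
  prime⇒2∤n∧n∤2 p 3≤n = [ Prime.notComposite p ∘ composite 3≤n , >⇒∤ 3≤n ]′

  e-adjacent : Prime n → 3 ≤ n → ∀ {x : Dih n} → x ≢ e → ODAdj e x
  e-adjacent p 3≤n x≢e with order-2-or-n p x≢e
  ... | inj₁ x-order = ODAdj-of-orders e-order x-order (λ ()) (inj₁ (1∣ 2))
  ... | inj₂ x-order = ODAdj-of-orders e-order x-order (<⇒≢ (<-trans (s≤s (s≤s z≤n)) 3≤n)) (inj₁ (1∣ n))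

  nonidentity-nonadjacent : Prime n → 3 ≤ n → ∀ {x y : Dih n} → x ≢ e → y ≢ e → ¬ ODAdj x y
  nonidentity-nonadjacent p 3≤n {x} {y} x≢e y≢e xy
    with order-2-or-n p x≢e | order-2-or-n p y≢e
  ... | inj₁ ox | inj₁ oy = proj₁ (ODAdj⇒orders xy ox oy) refl
  ... | inj₂ ox | inj₂ oy = proj₁ (ODAdj⇒orders xy ox oy) refl
  ... | inj₁ ox | inj₂ oy = prime⇒2∤n∧n∤2 p 3≤n (proj₂ (ODAdj⇒orders xy ox oy))
  ... | inj₂ ox | inj₁ oy = prime⇒2∤n∧n∤2 p 3≤n (Sum.swap (proj₂ (ODAdj⇒orders xy ox oy)))

  ODAdj-isStar : Prime n → 3 ≤ n → IsStar (ODAdj {n}) e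
  ODAdj-isStar p 3≤n x y = mk⇔ centred adjacent
    where
    centred : ODAdj x y → x ≢ y × (x ≡ e ⊎ y ≡ e)
    centred xy with x ≟ e | y ≟ e
    ... | yes x≡e | _       = proj₁ xy , inj₁ x≡e
    ... | no _    | yes y≡e = proj₁ xy , inj₂ y≡e
    ... | no x≢e  | no y≢e  = ⊥-elim (nonidentity-nonadjacent p 3≤n x≢e y≢e xy)
    adjacent : x ≢ y × (x ≡ e ⊎ y ≡ e) → ODAdj x y
    adjacent (x≢y , inj₁ refl) = e-adjacent p 3≤n (x≢y ∘ sym)
    adjacent (x≢y , inj₂ refl) = ODAdj-sym (e-adjacent p 3≤n x≢y)

  toℕ-Dih↔Fin-e : toℕ (Inverse.to (Dih↔Fin {n}) e) ≡ 0
  toℕ-Dih↔Fin-e = refl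

theorem2 : (n : ℕ) .{{_ : NonZero n}} → 3 ≤ n →
    (GraphIso (ODAdj {n}) (StarAdj {2 * n}) ⇔ Prime n)
theorem2 (suc m) 3≤n = mk⇔
  (λ iso → triangleFree⇒prime (<⇒≤ {2} 3≤n) (triangleFree-pullback iso StarAdj-triangleFree))
  (λ p → IsStar⇒GraphIso Dih↔Fin (toℕ-Dih↔Fin-e {m}) (ODAdj-isStar p 3≤n))
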